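{- Let $G$ be a signed multidigraph with $n\geq 2$ vertices, let $v\in V(G)$, and let $v^1$ be a duplication of $v$ (so $d(G,v)$ has vertex set $V(G)\cup\{v^1\}$). Then \[ I_{j}(d(G,v),X)\subseteq \langle x_{v},x_{v^1}, I_{j}(G,X)|_{x_v=0}\rangle \] for all $1\leq j\leq n$. Moreover, $I_{j}(d(G,v),X)$ is trivial if and only if $I_{j}(G,X)|_{x_v=0}$ is trivial.
   Context: $\mathcal{P}$ is a principal ideal domain. A signed multidigraph $G$ is a finite multidigraph with signs $\pm1$ on its arcs; for distinct vertices $u,w$, $m_{uw}$ is the number of arcs from $u$ to $w$ and $\sigma(uw)$ their sign. With one variable $x_u$ per vertex, the generalized Laplacian $L(G,X)$ has diagonal entries $x_u$ and off-diagonal entries $L(G,X)_{uw}=-\sigma(uw)m_{uw}1_{\mathcal P}$. The critical ideal $I_i(G,X)$ is the ideal of the polynomial ring $\mathcal P[X]$ generated by all $i\times i$ minors of $L(G,X)$; it is called trivial if it equals $\langle 1\rangle$. Duplicating $v$ means adding a new vertex $v^1$ (with variable $x_{v^1}$) such that for every vertex $u\neq v$ the arcs between $v^1$ and $u$ (in both directions, with multiplicities and signs) are exactly those between $v$ and $u$, and there are no arcs between $v$ and $v^1$; the result is $d(G,v)$. For an ideal $I$, $I|_{x_v=c}$ denotes the ideal generated by the images of its elements under the substitution $x_v\mapsto c$, regarded inside the polynomial ring of the larger graph. -}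

module Defs where

open import Level using (Level; _⊔_) renaming (suc to lsuc)
open import Algebra.Bundles using (CommutativeRing)
open import Data.Nat as ℕ using (ℕ; zero; suc)
open import Data.Fin as Fin using (Fin; zero; suc; punchIn; toℕ)
open import Data.Sign as S using (Sign)
open import Data.Product using (Σ; _×_; _,_; ∃)
open import Data.Sum using (_⊎_)
open import Relation.Nullary using (¬_; yes; no)
open import Relation.Binary.PropositionalEquality using (_≡_)
open import Function.Bundles using (_⇔_)

module _ {c ℓ : Level} (P : CommutativeRing c ℓ) where
  open CommutativeRing P using (Carrier; _≈_; _+_; _*_; -_; 0#; 1#)

  record IsIdealOf (I : Carrier → Set (c ⊔ ℓ)) : Set (c ⊔ ℓ) where
    field
      ∈-resp : ∀ {a b} → a ≈ b → I a → I b
      ∈-0    : I 0#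
      ∈-+    : ∀ {a b} → I a → I b → I (a + b)
      ∈-*    : ∀ r {a} → I a → I (r * a)

  record IsPID : Set (lsuc (c ⊔ ℓ)) where
    field
      nontrivial   : ¬ (1# ≈ 0#)
      noZeroDivs   : ∀ a b → a * b ≈ 0# → (a ≈ 0#) ⊎ (b ≈ 0#)
      allPrincipal : ∀ (I : Carrier → Set (c ⊔ ℓ)) → IsIdealOf I →
                     ∃ λ g → ∀ a → I a ⇔ (∃ λ r → a ≈ r * g)

-- The polynomial ring P[x_0,…,x_{k-1}] as the free commutative
-- P-algebra on k generators: syntax modulo the congruence generated by
-- the commutative-ring axioms and the ring structure of the constants.

  data Poly (k : ℕ) : Set c where
    con  : Carrier → Poly k
    var  : Fin k → Poly k
    _⊕_  : Poly k → Poly k → Poly k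
    _⊗_  : Poly k → Poly k → Poly k
    neg  : Poly k → Poly k

  infixl 6 _⊕_
  infixl 7 _⊗_
  infix 4 _≋_

  data _≋_ {k : ℕ} : Poly k → Poly k → Set (c ⊔ ℓ) where
    ≋-refl  : ∀ {p} → p ≋ p
    ≋-sym   : ∀ {p q} → p ≋ q → q ≋ p
    ≋-trans : ∀ {p q r} → p ≋ q → q ≋ r → p ≋ r
    ⊕-cong  : ∀ {p p' q q'} → p ≋ p' → q ≋ q' → p ⊕ q ≋ p' ⊕ q'
    ⊗-cong  : ∀ {p p' q q'} → p ≋ p' → q ≋ q' → p ⊗ q ≋ p' ⊗ q'
    neg-cong : ∀ {p q} → p ≋ q → neg p ≋ neg q
    ⊕-assoc : ∀ p q r → (p ⊕ q) ⊕ r ≋ p ⊕ (q ⊕ r)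
    ⊕-comm  : ∀ p q → p ⊕ q ≋ q ⊕ p
    ⊕-idˡ   : ∀ p → con 0# ⊕ p ≋ p
    neg-invˡ : ∀ p → neg p ⊕ p ≋ con 0#
    ⊗-assoc : ∀ p q r → (p ⊗ q) ⊗ r ≋ p ⊗ (q ⊗ r)
    ⊗-comm  : ∀ p q → p ⊗ q ≋ q ⊗ p
    ⊗-idˡ   : ∀ p → con 1# ⊗ p ≋ p
    ⊗-distribˡ : ∀ p q r → p ⊗ (q ⊕ r) ≋ (p ⊗ q) ⊕ (p ⊗ r)
    con-cong : ∀ {a b} → a ≈ b → con a ≋ con b
    con-+   : ∀ a b → con (a + b) ≋ con a ⊕ con b
    con-*   : ∀ a b → con (a * b) ≋ con a ⊗ con b
    con-neg : ∀ a → con (- a) ≋ neg (con a)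

  substP : ∀ {k m} → (Fin k → Poly m) → Poly k → Poly m
  substP σ (con a) = con a
  substP σ (var i) = σ i
  substP σ (p ⊕ q) = substP σ p ⊕ substP σ q
  substP σ (p ⊗ q) = substP σ p ⊗ substP σ q
  substP σ (neg p) = neg (substP σ p)

  data ⟨_⟩ {k : ℕ} {ℓs : Level} (S : Poly k → Set ℓs) : Poly k → Set (c ⊔ ℓ ⊔ ℓs) where
    gen  : ∀ {p} → S p → ⟨ S ⟩ p
    zro  : ⟨ S ⟩ (con 0#)
    add  : ∀ {p q} → ⟨ S ⟩ p → ⟨ S ⟩ q → ⟨ S ⟩ (p ⊕ q)
    mul  : ∀ r {p} → ⟨ S ⟩ p → ⟨ S ⟩ (r ⊗ p)
    resp : ∀ {p q} → p ≋ q → ⟨ S ⟩ p → ⟨ S ⟩ q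

  Trivial : ∀ {k ℓi} → (Poly k → Set ℓi) → Set (c ⊔ ℓ ⊔ ℓi)
  Trivial {k} I = ∀ (p : Poly k) → I p ⇔ ⟨ (λ q → q ≡ con 1#) ⟩ p

  altSign : ∀ {m} → ℕ → Poly m → Poly m
  altSign zero p = p
  altSign (suc zero) p = neg p
  altSign (suc (suc i)) p = altSign i p

  sumFin : ∀ {m} k → (Fin k → Poly m) → Poly m
  sumFin zero f = con 0#
  sumFin (suc k) f = f zero ⊕ sumFin k (λ i → f (suc i))

  det : ∀ {m} k → (Fin k → Fin k → Poly m) → Poly m
  det zero M = con 1#
  det (suc k) M =
    sumFin (suc k) (λ i → altSign (toℕ i)
      (M zero i ⊗ det k (λ r s → M (suc r) (punchIn i s))))

  StrictMono : ∀ {i n} → (Fin i → Fin n) → Set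
  StrictMono f = ∀ a b → a Fin.< b → f a Fin.< f b

  Minors : ∀ {m n} (i : ℕ) → (Fin n → Fin n → Poly m) → Poly m → Set c
  Minors {m} {n} i M p =
    Σ (Fin i → Fin n) λ rows → Σ (Fin i → Fin n) λ cols →
      StrictMono rows × StrictMono cols ×
      (p ≡ det i (λ a b → M (rows a) (cols b)))

record SignedMultidigraph (n : ℕ) : Set where
  field
    arcs : Fin n → Fin n → ℕ     -- m_uw (only used for u ≢ w)
    sign : Fin n → Fin n → Sign
open SignedMultidigraph public

-- duplication d(G,v): vertex set Fin (suc n); the new vertex v¹ is
-- 'zero', and the old vertex u of G is 'suc u'.
dup : ∀ {n} → SignedMultidigraph n → Fin n → SignedMultidigraph (suc n)
arcs (dup G v) zero zero = 0
arcs (dup G v) zero (suc u) with u Fin.≟ v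
... | yes _ = 0
... | no  _ = arcs G v u
arcs (dup G v) (suc u) zero with u Fin.≟ v
... | yes _ = 0
... | no  _ = arcs G u v
arcs (dup G v) (suc u) (suc w) = arcs G u w
sign (dup G v) zero zero = S.+
sign (dup G v) zero (suc u) = sign G v u
sign (dup G v) (suc u) zero = sign G u v
sign (dup G v) (suc u) (suc w) = sign G u w

module _ {c ℓ : Level} (P : CommutativeRing c ℓ) where
  open CommutativeRing P using (0#; 1#)

  natP : ∀ {k} → ℕ → Poly P k
  natP zero = con 0#
  natP (suc m) = con 1# ⊕ natP m

  signedP : ∀ {k} → Sign → Poly P k → Poly P k
  signedP S.+ p = p
  signedP S.- p = neg p

  Laplacian : ∀ {n} → SignedMultidigraph n → Fin n → Fin n → Poly P n
  Laplacian G u w with u Fin.≟ w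
  ... | yes _ = var u
  ... | no  _ = neg (signedP (sign G u w) (natP (arcs G u w)))

  CriticalIdeal : ∀ {n} → ℕ → SignedMultidigraph n → Poly P n → Set (c ⊔ ℓ)
  CriticalIdeal i G = ⟨_⟩ P (Minors P i (Laplacian G))

  -- I|_{x_v = 0}, regarded in the ring of d(G,v) (x_u ↦ x_{suc u})
  setZero : ∀ {n} → Fin n → Fin n → Poly P (suc n)
  setZero v u with u Fin.≟ v
  ... | yes _ = con 0#
  ... | no  _ = var (suc u)

  Restrict0 : ∀ {n ℓi} → Fin n → (Poly P n → Set ℓi) → Poly P (suc n) → Set (c ⊔ ℓ ⊔ ℓi)
  Restrict0 v I = ⟨_⟩ P (λ p → Σ (Poly P _) λ q → I q × (p ≡ substP P (setZero v) q))

  TargetIdeal : ∀ {n ℓi} → Fin n → (Poly P (suc n) → Set ℓi) → Poly P (suc n) → Set (c ⊔ ℓ ⊔ ℓi)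
  TargetIdeal v J = ⟨_⟩ P (λ p → (p ≡ var (suc v)) ⊎ (p ≡ var zero) ⊎ J p)

-- Write D = d(G,v), where the new vertex v¹ is
-- index 0, and let σ be the substitution x_v, x_{v¹} ↦ 0 on the ring of D.
--  * σ turns L(D) into L(G)|_{x_v=0} with both v and v¹ indexed by v
--    (σ-Laplacian); so σ of a j×j minor of L(D) is the determinant of a j×j
--    array of entries of L(G)|_{x_v=0} whose row and column indices need be
--    neither increasing nor distinct.
--  * Such a determinant is 0 or ± a genuine minor (det-reindex∈Minors), hence
--    lies in J = I_j(G)|_{x_v=0}; and p - σ(p) ∈ ⟨x_v, x_{v¹}⟩ for every p
--    (substP-difference).  Together: I_j(D) ⊆ ⟨x_v, x_{v¹}, J⟩.
--  * Conversely J ⊆ I_j(D), reading column v¹ in place of v (Laplacian-twin);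
--    and σ maps ⟨x_v, x_{v¹}, J⟩ into J while fixing 1.  So 1 ∈ I_j(D) iff 1 ∈ J.

module Submission where

open import Defs
open import Level using (Level; _⊔_)
open import Algebra.Bundles using (CommutativeRing)
open import Data.Nat as ℕ using (ℕ; zero; suc; _≤_)
import Data.Nat.Properties as ℕP
open import Data.Fin as Fin using (Fin; zero; suc; punchIn; punchOut; toℕ)
import Data.Fin.Properties as FinP
open import Data.Maybe using (nothing)
open import Data.Product using (Σ; _×_; _,_; proj₁; proj₂)
open import Data.Sum using (_⊎_; inj₁; inj₂)
open import Data.Empty using (⊥-elim)
open import Data.Sign as Sign using (Sign)
open import Relation.Nullary using (¬_; Dec; yes; no)
open import Relation.Binary.Definitions using (tri<; tri≈; tri>)
open import Relation.Binary.Structures using (IsEquivalence)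
open import Relation.Binary.PropositionalEquality as Eq
  using (_≡_; _≢_; refl; sym; trans; cong; cong₂; subst)
open import Function.Bundles using (_⇔_; Equivalence; mk⇔)
open import Tactic.RingSolver.Core.AlmostCommutativeRing using (AlmostCommutativeRing; fromCommutativeRing)
open import Tactic.RingSolver.Core.Expression using () renaming (_⊕_ to _:+_; _⊗_ to _:*_)

-- Index maps: sorting a map Fin k → Fin n

-- strictly increasing index maps (this is Defs' StrictMono, which is
-- parametrised by a ring although it does not depend on it)
Increasing : ∀ {k n} → (Fin k → Fin n) → Set
Increasing f = ∀ a b → a Fin.< b → f a Fin.< f b

-- a permutation of Fin k, coded by the image p of 0 followed by the code
-- of the permutation of the remaining positions, placed around p
data PermCode : ℕ → Set where
  [] : PermCode zero
  _∷_ : ∀ {k} → Fin (suc k) → PermCode k → PermCode (suc k)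

⟦_⟧ : ∀ {k} → PermCode k → Fin k → Fin k
⟦ p ∷ π ⟧ zero = p
⟦ p ∷ π ⟧ (suc s) = punchIn p (⟦ π ⟧ s)

-- the exponent of the sign of ⟦ π ⟧ (its number of inversions)
inversions : ∀ {k} → PermCode k → ℕ
inversions [] = 0
inversions (p ∷ π) = toℕ p ℕ.+ inversions π

idCode : ∀ k → PermCode k
idCode zero = []
idCode (suc k) = zero ∷ idCode k

⟦⟧-surjective : ∀ {k} (π : PermCode k) y → Σ (Fin k) λ x → ⟦ π ⟧ x ≡ y
⟦⟧-surjective (p ∷ π) y with p FinP.≟ y
... | yes p≡y = zero , p≡y
... | no p≢y with ⟦⟧-surjective π (punchOut p≢y)
...   | x , πx≡ = suc x , trans (cong (punchIn p) πx≡) (FinP.punchIn-punchOut p≢y)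

prepend : ∀ {k n} → Fin n → (Fin k → Fin n) → Fin (suc k) → Fin n
prepend x h zero = x
prepend x h (suc s) = h s

prepend-increasing : ∀ {k n} (x : Fin n) (h : Fin k → Fin n) →
  (∀ b → x Fin.< h b) → Increasing h → Increasing (prepend x h)
prepend-increasing x h x<h h↑ zero (suc b) _ = x<h b
prepend-increasing x h x<h h↑ (suc a) (suc b) (ℕ.s≤s a<b) = h↑ a b a<b

record Insertion {k n} (h : Fin k → Fin n) (x : Fin n) : Set where
  constructor insertion
  field
    position    : Fin (suc k)
    extended    : Fin (suc k) → Fin n
    increasing  : Increasing extended
    at-position : extended position ≡ x
    elsewhere   : ∀ s → extended (punchIn position s) ≡ h s

insert : ∀ {k n} (h : Fin k → Fin n) → Increasing h →
  (x : Fin n) → (∀ s → h s ≢ x) → Insertion h x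
insert {zero} h h↑ x _ = insertion zero (λ _ → x) (λ { zero zero () }) refl (λ ())
insert {suc k} h h↑ x x∉h with FinP.<-cmp x (h zero)
... | tri< x<h₀ _ _ = insertion zero (prepend x h) (prepend-increasing x h x<h h↑) refl (λ _ → refl)
  where
  x<h : ∀ b → x Fin.< h b
  x<h zero = x<h₀
  x<h (suc b) = FinP.<-trans x<h₀ (h↑ zero (suc b) (ℕ.s≤s ℕ.z≤n))
... | tri≈ _ x≡h₀ _ = ⊥-elim (x∉h zero (sym x≡h₀))
... | tri> _ _ h₀<x = shift (insert (λ s → h (suc s)) tail↑ x (λ s → x∉h (suc s)))
  where
  tail↑ : Increasing (λ s → h (suc s))
  tail↑ a b a<b = h↑ (suc a) (suc b) (ℕ.s≤s a<b)
  shift : Insertion (λ s → h (suc s)) x → Insertion h x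
  shift (insertion p g g↑ gp≡x g∘punchIn) =
    insertion (suc p) (prepend (h zero) g) (prepend-increasing (h zero) g h₀<g g↑) gp≡x extended-elsewhere
    where
    h₀<g : ∀ b → h zero Fin.< g b
    h₀<g b with b FinP.≟ p
    ... | yes refl = subst (h zero Fin.<_) (sym gp≡x) h₀<x
    ... | no b≢p = subst (h zero Fin.<_)
      (sym (trans (cong g (sym (FinP.punchIn-punchOut (λ p≡b → b≢p (sym p≡b))))) (g∘punchIn _)))
      (h↑ zero (suc _) (ℕ.s≤s ℕ.z≤n))
    extended-elsewhere : ∀ s → prepend (h zero) g (punchIn (suc p) s) ≡ h s
    extended-elsewhere zero = refl
    extended-elsewhere (suc s) = g∘punchIn s

Repeats : ∀ {k n} → (Fin k → Fin n) → Set
Repeats {k} g = Σ (Fin k) λ a → Σ (Fin k) λ b → a ≢ b × g a ≡ g b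

Sortable : ∀ {k n} → (Fin k → Fin n) → Set
Sortable {k} {n} g = Σ (Fin k → Fin n) λ g↑ → Increasing g↑ ×
  Σ (PermCode k) λ π → ∀ x → g x ≡ g↑ (⟦ π ⟧ x)

sortable-cons : ∀ {k n} (g : Fin (suc k) → Fin n) →
  ¬ (Σ (Fin k) λ x → g (suc x) ≡ g zero) → Sortable (λ x → g (suc x)) → Sortable g
sortable-cons g g₀-new (h , h↑ , π , g≡h∘π) with insert h h↑ (g zero) g₀∉h
  where
  g₀∉h : ∀ s → h s ≢ g zero
  g₀∉h s hs≡g₀ with ⟦⟧-surjective π s
  ... | x , πx≡s = g₀-new (x , trans (g≡h∘π x) (trans (cong h πx≡s) hs≡g₀))
... | insertion p h' h'↑ h'p≡g₀ h'∘punchIn = h' , h'↑ , p ∷ π , g≡h'∘π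
  where
  g≡h'∘π : ∀ x → g x ≡ h' (⟦ p ∷ π ⟧ x)
  g≡h'∘π zero = sym h'p≡g₀
  g≡h'∘π (suc x) = trans (g≡h∘π x) (sym (h'∘punchIn (⟦ π ⟧ x)))

repeats-or-sortable : ∀ {k n} (g : Fin k → Fin n) → Repeats g ⊎ Sortable g
repeats-or-sortable {zero} g = inj₂ ((λ ()) , (λ ()) , [] , (λ ()))
repeats-or-sortable {suc k} g with FinP.any? (λ x → g (suc x) FinP.≟ g zero)
... | yes (x , e) = inj₁ (suc x , zero , (λ ()) , e)
... | no g₀-new with repeats-or-sortable (λ x → g (suc x))
...   | inj₁ (a , b , a≢b , e) = inj₁ (suc a , suc b , (λ e' → a≢b (FinP.suc-injective e')) , e)
...   | inj₂ tail-sortable = inj₂ (sortable-cons g g₀-new tail-sortable)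

lift : ∀ {n} → (Fin n → Fin n) → Fin (suc n) → Fin (suc n)
lift f zero = zero
lift f (suc s) = suc (f s)

swap₀₁ : ∀ {n} → Fin (suc (suc n)) → Fin (suc (suc n))
swap₀₁ zero = suc zero
swap₀₁ (suc zero) = zero
swap₀₁ (suc (suc s)) = suc (suc s)

toFront : ∀ {n} → Fin (suc n) → Fin (suc n) → Fin (suc n)
toFront p zero = p
toFront p (suc s) = punchIn p s

toFront-zero : ∀ {n} (b : Fin (suc n)) → toFront zero b ≡ b
toFront-zero zero = refl
toFront-zero (suc b) = refl

toFront-suc : ∀ {n} (q : Fin (suc n)) b → toFront (suc q) b ≡ lift (toFront q) (swap₀₁ b)
toFront-suc q zero = refl
toFront-suc q (suc zero) = refl
toFront-suc q (suc (suc b)) = refl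

⟦⟧-∷ : ∀ {k} (p : Fin (suc k)) (π : PermCode k) b → ⟦ p ∷ π ⟧ b ≡ toFront p (lift ⟦ π ⟧ b)
⟦⟧-∷ p π zero = refl
⟦⟧-∷ p π (suc b) = refl

swap₀₁-suc : ∀ {n} (s : Fin (suc n)) → swap₀₁ (suc s) ≡ punchIn (suc zero) s
swap₀₁-suc zero = refl
swap₀₁-suc (suc s) = refl

swap₀₁-punchIn₁ : ∀ {n} (s : Fin (suc n)) → swap₀₁ (punchIn (suc zero) s) ≡ suc s
swap₀₁-punchIn₁ zero = refl
swap₀₁-punchIn₁ (suc s) = refl

swap₀₁-punchIn : ∀ {n} (i : Fin (suc n)) (s : Fin (suc (suc n))) →
  swap₀₁ (punchIn (suc (suc i)) s) ≡ punchIn (suc (suc i)) (swap₀₁ s)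
swap₀₁-punchIn i zero = refl
swap₀₁-punchIn i (suc zero) = refl
swap₀₁-punchIn i (suc (suc s)) = refl

-- The polynomial ring P[x_0,…,x_{k-1}] as a commutative ring

module PolyRing {c ℓ : Level} (P : CommutativeRing c ℓ) (k : ℕ) where
  open CommutativeRing P using (0#; 1#)

  infix 4 _≈_
  _≈_ : Poly P k → Poly P k → Set (c ⊔ ℓ)
  _≈_ = _≋_ P

  𝟘 𝟙 : Poly P k
  𝟘 = con 0#
  𝟙 = con 1#

  polyRing : CommutativeRing c (c ⊔ ℓ)
  polyRing = record
    { Carrier = Poly P k ; _≈_ = _≈_ ; _+_ = _⊕_ ; _*_ = _⊗_ ; -_ = neg ; 0# = 𝟘 ; 1# = 𝟙
    ; isCommutativeRing = record
      { isRing = record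
        { +-isAbelianGroup = record
          { isGroup = record
            { isMonoid = record
              { isSemigroup = record
                { isMagma = record { isEquivalence = isEquivalence ; ∙-cong = ⊕-cong }
                ; assoc = ⊕-assoc }
              ; identity = ⊕-idˡ , ⊕-idʳ }
            ; inverse = neg-invˡ , neg-invʳ
            ; ⁻¹-cong = neg-cong }
          ; comm = ⊕-comm }
        ; *-cong = ⊗-cong ; *-assoc = ⊗-assoc ; *-identity = ⊗-idˡ , ⊗-idʳ
        ; distrib = ⊗-distribˡ , ⊗-distribʳ }
      ; *-comm = ⊗-comm } }
    where
    isEquivalence : IsEquivalence _≈_
    isEquivalence = record { refl = ≋-refl ; sym = ≋-sym ; trans = ≋-trans }
    ⊕-idʳ : ∀ p → p ⊕ 𝟘 ≈ p
    ⊕-idʳ p = ≋-trans (⊕-comm _ _) (⊕-idˡ p)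
    neg-invʳ : ∀ p → p ⊕ neg p ≈ 𝟘
    neg-invʳ p = ≋-trans (⊕-comm _ _) (neg-invˡ p)
    ⊗-idʳ : ∀ p → p ⊗ 𝟙 ≈ p
    ⊗-idʳ p = ≋-trans (⊗-comm _ _) (⊗-idˡ p)
    ⊗-distribʳ : ∀ p q r → (q ⊕ r) ⊗ p ≈ (q ⊗ p) ⊕ (r ⊗ p)
    ⊗-distribʳ p q r = ≋-trans (⊗-comm _ _)
      (≋-trans (⊗-distribˡ p q r) (⊕-cong (⊗-comm _ _) (⊗-comm _ _)))

  open CommutativeRing polyRing public
    using (setoid; +-identityʳ; -‿inverseʳ; *-identityʳ; zeroʳ)
  open import Algebra.Properties.Ring (CommutativeRing.ring polyRing) public
    using (-‿involutive; -‿distribʳ-*; -1*x≈-x; -0#≈0#; -‿+-comm)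
  open import Relation.Binary.Reasoning.Setoid setoid public

  ACR : AlmostCommutativeRing c (c ⊔ ℓ)
  ACR = fromCommutativeRing polyRing (λ _ → nothing)
  open import Tactic.RingSolver.NonReflective ACR public using (solve; _⊜_)

  ≡⇒≈ : ∀ {p q} → p ≡ q → p ≈ q
  ≡⇒≈ refl = ≋-refl

  ⊕-interchange : ∀ a b c d → (a ⊕ b) ⊕ (c ⊕ d) ≈ (a ⊕ c) ⊕ (b ⊕ d)
  ⊕-interchange = solve 4 (λ a b c d → ((a :+ b) :+ (c :+ d)) ⊜ ((a :+ c) :+ (b :+ d))) ≋-refl

  alt : ℕ → Poly P k → Poly P k
  alt = altSign P

  alt-cong : ∀ e {p q} → p ≈ q → alt e p ≈ alt e q
  alt-cong zero p≈q = p≈q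
  alt-cong (suc zero) p≈q = neg-cong p≈q
  alt-cong (suc (suc e)) p≈q = alt-cong e p≈q

  alt-suc : ∀ e p → alt (suc e) p ≈ neg (alt e p)
  alt-suc zero p = ≋-refl
  alt-suc (suc zero) p = ≋-sym (-‿involutive p)
  alt-suc (suc (suc e)) p = alt-suc e p

  alt-neg : ∀ e p → alt e (neg p) ≈ neg (alt e p)
  alt-neg zero p = ≋-refl
  alt-neg (suc zero) p = ≋-refl
  alt-neg (suc (suc e)) p = alt-neg e p

  alt-⊗ : ∀ e a p → alt e (a ⊗ p) ≈ a ⊗ alt e p
  alt-⊗ zero a p = ≋-refl
  alt-⊗ (suc zero) a p = -‿distribʳ-* a p
  alt-⊗ (suc (suc e)) a p = alt-⊗ e a p

  alt-+ : ∀ e f p → alt e (alt f p) ≈ alt (e ℕ.+ f) p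
  alt-+ zero f p = ≋-refl
  alt-+ (suc zero) f p = ≋-sym (alt-suc f p)
  alt-+ (suc (suc e)) f p = alt-+ e f p

  alt-≡ : ∀ {e f} p → e ≡ f → alt e p ≈ alt f p
  alt-≡ p refl = ≋-refl

  alt-comm : ∀ e f p → alt e (alt f p) ≈ alt f (alt e p)
  alt-comm e f p = ≋-trans (alt-+ e f p) (≋-trans (alt-≡ p (ℕP.+-comm e f)) (≋-sym (alt-+ f e p)))

  alt-involutive : ∀ e p → alt e (alt e p) ≈ p
  alt-involutive zero p = ≋-refl
  alt-involutive (suc zero) p = -‿involutive p
  alt-involutive (suc (suc e)) p = alt-involutive e p

  alt-𝟘 : ∀ e → alt e 𝟘 ≈ 𝟘
  alt-𝟘 zero = ≋-refl
  alt-𝟘 (suc zero) = -0#≈0#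
  alt-𝟘 (suc (suc e)) = alt-𝟘 e

  sum : ∀ n → (Fin n → Poly P k) → Poly P k
  sum = sumFin P

  sum-cong : ∀ n {f g : Fin n → Poly P k} → (∀ i → f i ≈ g i) → sum n f ≈ sum n g
  sum-cong zero f≈g = ≋-refl
  sum-cong (suc n) f≈g = ⊕-cong (f≈g zero) (sum-cong n (λ i → f≈g (suc i)))

  sum-𝟘 : ∀ n (f : Fin n → Poly P k) → (∀ i → f i ≈ 𝟘) → sum n f ≈ 𝟘
  sum-𝟘 zero f f≈𝟘 = ≋-refl
  sum-𝟘 (suc n) f f≈𝟘 = ≋-trans (⊕-cong (f≈𝟘 zero) (sum-𝟘 n _ (λ i → f≈𝟘 (suc i)))) (⊕-idˡ _)

  sum-⊕ : ∀ n (f g : Fin n → Poly P k) → sum n (λ i → f i ⊕ g i) ≈ sum n f ⊕ sum n g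
  sum-⊕ zero f g = ≋-sym (⊕-idˡ _)
  sum-⊕ (suc n) f g = ≋-trans (⊕-cong ≋-refl (sum-⊕ n _ _)) (⊕-interchange _ _ _ _)

  sum-neg : ∀ n (f : Fin n → Poly P k) → sum n (λ i → neg (f i)) ≈ neg (sum n f)
  sum-neg zero f = ≋-sym -0#≈0#
  sum-neg (suc n) f = ≋-trans (⊕-cong ≋-refl (sum-neg n _)) (-‿+-comm _ _)

  sum-⊗ : ∀ n a (f : Fin n → Poly P k) → a ⊗ sum n f ≈ sum n (λ i → a ⊗ f i)
  sum-⊗ zero a f = zeroʳ a
  sum-⊗ (suc n) a f = ≋-trans (⊗-distribˡ _ _ _) (⊕-cong ≋-refl (sum-⊗ n a _))

  alt-sum : ∀ n e (f : Fin n → Poly P k) → alt e (sum n f) ≈ sum n (λ i → alt e (f i))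
  alt-sum n zero f = ≋-refl
  alt-sum n (suc zero) f = ≋-sym (sum-neg n f)
  alt-sum n (suc (suc e)) f = alt-sum n e f

  sum-swap : ∀ n m (f : Fin n → Fin m → Poly P k) →
    sum n (λ i → sum m (f i)) ≈ sum m (λ j → sum n (λ i → f i j))
  sum-swap zero m f = ≋-sym (sum-𝟘 m _ (λ _ → ≋-refl))
  sum-swap (suc n) m f = begin
    sum m (f zero) ⊕ sum n (λ i → sum m (f (suc i)))         ≈⟨ ⊕-cong ≋-refl (sum-swap n m _) ⟩
    sum m (f zero) ⊕ sum m (λ j → sum n (λ i → f (suc i) j)) ≈⟨ sum-⊕ m _ _ ⟨
    sum m (λ j → f zero j ⊕ sum n (λ i → f (suc i) j))       ∎

  ∈-neg : ∀ {ℓs} {S : Poly P k → Set ℓs} {p} → ⟨_⟩ P S p → ⟨_⟩ P S (neg p)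
  ∈-neg p∈I = resp (-1*x≈-x _) (mul (neg 𝟙) p∈I)

  ∈-alt : ∀ {ℓs} {S : Poly P k → Set ℓs} e {p} → ⟨_⟩ P S p → ⟨_⟩ P S (alt e p)
  ∈-alt zero p∈I = p∈I
  ∈-alt (suc zero) p∈I = ∈-neg p∈I
  ∈-alt (suc (suc e)) p∈I = ∈-alt e p∈I

-- Determinants: transposition, column permutations, repeated columns

module Determinants {c ℓ : Level} (P : CommutativeRing c ℓ) (k : ℕ) where
  open PolyRing P k

  Matrix : ℕ → Set c
  Matrix n = Fin n → Fin n → Poly P k

  Det : ∀ n → Matrix n → Poly P k
  Det = det P

  _ᵀ : ∀ {n} → Matrix n → Matrix n
  (M ᵀ) a b = M b a

  _∘ᶜ_ : ∀ {m n j} → (Fin m → Fin n → Poly P k) → (Fin j → Fin n) → Fin m → Fin j → Poly P k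
  (B ∘ᶜ g) a b = B a (g b)

  minor : ∀ {n} → Matrix (suc n) → Fin (suc n) → Matrix n
  minor M i r s = M (suc r) (punchIn i s)

  det-cong : ∀ n {M N : Matrix n} → (∀ a b → M a b ≈ N a b) → Det n M ≈ Det n N
  det-cong zero M≈N = ≋-refl
  det-cong (suc n) M≈N = sum-cong (suc n) (λ i → alt-cong (toℕ i)
    (⊗-cong (M≈N zero i) (det-cong n (λ r s → M≈N (suc r) (punchIn i s)))))

  det-cols-≡ : ∀ n {m} (B : Fin n → Fin m → Poly P k) {f g : Fin n → Fin m} →
    (∀ b → f b ≡ g b) → Det n (B ∘ᶜ f) ≈ Det n (B ∘ᶜ g)
  det-cols-≡ n B f≡g = det-cong n (λ a b → ≡⇒≈ (cong (B a) (f≡g b)))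

  -- Expanding det M along row 0 and then each minor along
  -- its first column (i.e. column 0 of M) writes det M as
  --   M₀₀ · det (minor M 0) + Σ_{i,j} crossTerm M i j,
  -- an expression visibly symmetric under transposition.
  doubleMinorᵀ : ∀ {n} → Matrix (suc (suc n)) → Fin (suc n) → Fin (suc n) → Matrix n
  doubleMinorᵀ M i j r s = M (suc (punchIn i s)) (suc (punchIn j r))

  crossTerm : ∀ {n} → Matrix (suc (suc n)) → Fin (suc n) → Fin (suc n) → Poly P k
  crossTerm {n} M i j =
    alt (suc (toℕ i ℕ.+ toℕ j)) (M zero (suc j) ⊗ (M (suc i) zero ⊗ Det n (doubleMinorᵀ M i j)))

  det-expand₂ : ∀ n → (∀ N → Det (suc n) (N ᵀ) ≈ Det (suc n) N) → ∀ M →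
    Det (suc (suc n)) M ≈
      (M zero zero ⊗ Det (suc n) (minor M zero)) ⊕ sum (suc n) (λ j → sum (suc n) (λ i → crossTerm M i j))
  det-expand₂ n transpose-minor M = ⊕-cong ≋-refl (sum-cong (suc n) expand-minor)
    where
    expand-minor : ∀ j → alt (suc (toℕ j)) (M zero (suc j) ⊗ Det (suc n) (minor M (suc j)))
                         ≈ sum (suc n) (λ i → crossTerm M i j)
    expand-minor j = begin
      alt (suc (toℕ j)) (a ⊗ Det (suc n) (minor M (suc j)))
        ≈⟨ alt-cong (suc (toℕ j)) (⊗-cong ≋-refl (transpose-minor (minor M (suc j)))) ⟨
      alt (suc (toℕ j)) (a ⊗ sum (suc n) t)
        ≈⟨ alt-cong (suc (toℕ j)) (sum-⊗ (suc n) a t) ⟩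
      alt (suc (toℕ j)) (sum (suc n) (λ i → a ⊗ t i))
        ≈⟨ alt-sum (suc n) (suc (toℕ j)) (λ i → a ⊗ t i) ⟩
      sum (suc n) (λ i → alt (suc (toℕ j)) (a ⊗ t i))
        ≈⟨ sum-cong (suc n) signs ⟩
      sum (suc n) (λ i → crossTerm M i j) ∎
      where
      a : Poly P k
      a = M zero (suc j)
      t : Fin (suc n) → Poly P k
      t i = alt (toℕ i) (M (suc i) zero ⊗ Det n (doubleMinorᵀ M i j))
      signs : ∀ i → alt (suc (toℕ j)) (a ⊗ t i) ≈ crossTerm M i j
      signs i = ≋-trans (alt-cong (suc (toℕ j)) (≋-sym (alt-⊗ (toℕ i) a _)))
        (≋-trans (alt-+ (suc (toℕ j)) (toℕ i) _)
          (alt-≡ (a ⊗ (M (suc i) zero ⊗ Det n (doubleMinorᵀ M i j))) (cong suc (ℕP.+-comm (toℕ j) (toℕ i)))))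

  det-transpose : ∀ n (M : Matrix n) → Det n (M ᵀ) ≈ Det n M
  det-transpose zero M = ≋-refl
  det-transpose (suc zero) M = ≋-refl
  det-transpose (suc (suc n)) M = begin
    Det (suc (suc n)) (M ᵀ)
      ≈⟨ det-expand₂ n (det-transpose (suc n)) (M ᵀ) ⟩
    (M zero zero ⊗ Det (suc n) (minor M zero ᵀ)) ⊕ sum (suc n) (λ j → sum (suc n) (λ i → crossTerm (M ᵀ) i j))
      ≈⟨ ⊕-cong (⊗-cong ≋-refl (det-transpose (suc n) (minor M zero)))
                (sum-cong (suc n) λ j → sum-cong (suc n) λ i → crossTerm-transpose i j) ⟩
    (M zero zero ⊗ Det (suc n) (minor M zero)) ⊕ sum (suc n) (λ j → sum (suc n) (λ i → crossTerm M j i))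
      ≈⟨ ⊕-cong ≋-refl (sum-swap (suc n) (suc n) (λ j i → crossTerm M j i)) ⟩
    (M zero zero ⊗ Det (suc n) (minor M zero)) ⊕ sum (suc n) (λ i → sum (suc n) (λ j → crossTerm M j i))
      ≈⟨ det-expand₂ n (det-transpose (suc n)) M ⟨
    Det (suc (suc n)) M ∎
    where
    ⊗-leftComm : ∀ a b c → a ⊗ (b ⊗ c) ≈ b ⊗ (a ⊗ c)
    ⊗-leftComm = solve 3 (λ a b c → (a :* (b :* c)) ⊜ (b :* (a :* c))) ≋-refl
    crossTerm-transpose : ∀ i j → crossTerm (M ᵀ) i j ≈ crossTerm M j i
    crossTerm-transpose i j =
      ≋-trans (alt-≡ (M (suc j) zero ⊗ (M zero (suc i) ⊗ Det n (doubleMinorᵀ (M ᵀ) i j)))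
                     (cong suc (ℕP.+-comm (toℕ i) (toℕ j))))
        (alt-cong (suc (toℕ j ℕ.+ toℕ i)) (≋-trans (⊗-leftComm _ _ _)
          (⊗-cong ≋-refl (⊗-cong ≋-refl (det-transpose n (doubleMinorᵀ M j i))))))

  det-expandCol₀ : ∀ n (M : Matrix (suc n)) →
    Det (suc n) M ≈ sum (suc n) (λ i → alt (toℕ i) (M i zero ⊗ Det n (λ r s → M (punchIn i r) (suc s))))
  det-expandCol₀ n M = begin
    Det (suc n) M      ≈⟨ det-transpose (suc n) M ⟨
    Det (suc n) (M ᵀ)  ≈⟨ sum-cong (suc n) (λ i → alt-cong (toℕ i)
                            (⊗-cong {p = M i zero} ≋-refl (det-transpose n (λ r s → M (punchIn i r) (suc s))))) ⟩
    sum (suc n) (λ i → alt (toℕ i) (M i zero ⊗ Det n (λ r s → M (punchIn i r) (suc s)))) ∎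

  -- the terms of the row-0 expansion of an (n+2)-matrix from columns ≥ 2, so that
  -- Det M = M₀₀ · det (minor M 0) - M₀₁ · det (minor M 1) + laterTerms n M
  laterTerms : ∀ n → Matrix (suc (suc n)) → Poly P k
  laterTerms n M = sum n (λ i → alt (toℕ i) (M zero (suc (suc i)) ⊗ Det (suc n) (minor M (suc (suc i)))))

  -- swapping the first two columns changes the sign; the minors at the later
  -- columns have their first two columns swapped, whence the mutual induction
  det-swap₀₁ : ∀ n (M : Matrix (suc (suc n))) → Det (suc (suc n)) (M ∘ᶜ swap₀₁) ≈ neg (Det (suc (suc n)) M)
  laterTerms-swap₀₁ : ∀ n (M : Matrix (suc (suc n))) → laterTerms n (M ∘ᶜ swap₀₁) ≈ neg (laterTerms n M)

  det-swap₀₁ n M = begin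
    (M zero (suc zero) ⊗ Det (suc n) (minor (M ∘ᶜ swap₀₁) zero)) ⊕
      (neg (M zero zero ⊗ Det (suc n) (minor (M ∘ᶜ swap₀₁) (suc zero))) ⊕ laterTerms n (M ∘ᶜ swap₀₁))
      ≈⟨ ⊕-cong (⊗-cong ≋-refl (det-cols-≡ (suc n) (λ r → M (suc r)) swap₀₁-suc))
                (⊕-cong (neg-cong (⊗-cong ≋-refl (det-cols-≡ (suc n) (λ r → M (suc r)) swap₀₁-punchIn₁)))
                        (laterTerms-swap₀₁ n M)) ⟩
    (M zero (suc zero) ⊗ Det (suc n) (minor M (suc zero))) ⊕
      (neg (M zero zero ⊗ Det (suc n) (minor M zero)) ⊕ neg (laterTerms n M))
      ≈⟨ rearrange _ _ _ ⟩
    neg ((M zero zero ⊗ Det (suc n) (minor M zero)) ⊕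
      (neg (M zero (suc zero) ⊗ Det (suc n) (minor M (suc zero))) ⊕ laterTerms n M)) ∎
    where
    rearrange : ∀ x y z → x ⊕ (neg y ⊕ neg z) ≈ neg (y ⊕ (neg x ⊕ z))
    rearrange x y z = ≋-sym (begin
      neg (y ⊕ (neg x ⊕ z))         ≈⟨ -‿+-comm y _ ⟨
      neg y ⊕ neg (neg x ⊕ z)       ≈⟨ ⊕-cong ≋-refl (≋-trans (≋-sym (-‿+-comm (neg x) z))
                                                              (⊕-cong (-‿involutive x) ≋-refl)) ⟩
      neg y ⊕ (x ⊕ neg z)           ≈⟨ ⊕-leftComm (neg y) x (neg z) ⟩
      x ⊕ (neg y ⊕ neg z)           ∎)
      where
      ⊕-leftComm : ∀ a b c → a ⊕ (b ⊕ c) ≈ b ⊕ (a ⊕ c)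
      ⊕-leftComm = solve 3 (λ a b c → (a :+ (b :+ c)) ⊜ (b :+ (a :+ c))) ≋-refl

  laterTerms-swap₀₁ zero M = ≋-sym -0#≈0#
  laterTerms-swap₀₁ (suc n) M = ≋-trans (sum-cong (suc n) swap-term) (sum-neg (suc n) term)
    where
    term : Fin (suc n) → Poly P k
    term i = alt (toℕ i) (M zero (suc (suc i)) ⊗ Det (suc (suc n)) (minor M (suc (suc i))))
    swap-term : ∀ i → alt (toℕ i) (M zero (suc (suc i)) ⊗ Det (suc (suc n)) (minor (M ∘ᶜ swap₀₁) (suc (suc i))))
                      ≈ neg (term i)
    swap-term i = ≋-trans (alt-cong (toℕ i) (⊗-cong ≋-refl
        (≋-trans (det-cols-≡ (suc (suc n)) (λ r → M (suc r)) (swap₀₁-punchIn i))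
                 (det-swap₀₁ n (minor M (suc (suc i)))))))
      (≋-trans (alt-cong (toℕ i) (≋-sym (-‿distribʳ-* _ _))) (alt-neg (toℕ i) _))

  det-equalCols₀₁ : ∀ n (M : Matrix (suc (suc n))) → (∀ a → M a zero ≈ M a (suc zero)) →
    Det (suc (suc n)) M ≈ 𝟘
  laterTerms-equalCols₀₁ : ∀ n (M : Matrix (suc (suc n))) → (∀ a → M a zero ≈ M a (suc zero)) →
    laterTerms n M ≈ 𝟘

  det-equalCols₀₁ n M cols≈ = begin
    (M zero zero ⊗ Det (suc n) (minor M zero)) ⊕
      (neg (M zero (suc zero) ⊗ Det (suc n) (minor M (suc zero))) ⊕ laterTerms n M)
      ≈⟨ ⊕-cong ≋-refl (⊕-cong (neg-cong (⊗-cong (≋-sym (cols≈ zero)) (det-cong (suc n) minors≈)))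
                                (laterTerms-equalCols₀₁ n M cols≈)) ⟩
    (M zero zero ⊗ Det (suc n) (minor M zero)) ⊕ (neg (M zero zero ⊗ Det (suc n) (minor M zero)) ⊕ 𝟘)
      ≈⟨ cancel _ ⟩
    𝟘 ∎
    where
    minors≈ : ∀ r s → minor M (suc zero) r s ≈ minor M zero r s
    minors≈ r zero = cols≈ (suc r)
    minors≈ r (suc s) = ≋-refl
    cancel : ∀ x → x ⊕ (neg x ⊕ 𝟘) ≈ 𝟘
    cancel x = ≋-trans (⊕-cong ≋-refl (+-identityʳ (neg x))) (-‿inverseʳ x)

  laterTerms-equalCols₀₁ zero M cols≈ = ≋-refl
  laterTerms-equalCols₀₁ (suc n) M cols≈ = sum-𝟘 (suc n) _ λ i →
    -- every later minor still has equal first two columns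
    ≋-trans (alt-cong (toℕ i) (≋-trans (⊗-cong {p = M zero (suc (suc i))} ≋-refl
        (det-equalCols₀₁ n (minor M (suc (suc i))) (λ a → cols≈ (suc a)))) (zeroʳ _)))
      (alt-𝟘 (toℕ i))

  det-lift : ∀ n (f : Fin n → Fin n) e → (∀ N → Det n (N ∘ᶜ f) ≈ alt e (Det n N)) →
    ∀ M → Det (suc n) (M ∘ᶜ lift f) ≈ alt e (Det (suc n) M)
  det-lift n f e f-sign M = begin
    Det (suc n) (M ∘ᶜ lift f)
      ≈⟨ det-expandCol₀ n (M ∘ᶜ lift f) ⟩
    sum (suc n) (λ i → alt (toℕ i) (M i zero ⊗ Det n (M₀ i ∘ᶜ f)))
      ≈⟨ sum-cong (suc n) (λ i → alt-cong (toℕ i) (⊗-cong {p = M i zero} ≋-refl (f-sign (M₀ i)))) ⟩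
    sum (suc n) (λ i → alt (toℕ i) (M i zero ⊗ alt e (Det n (M₀ i))))
      ≈⟨ sum-cong (suc n) (λ i → ≋-trans (alt-cong (toℕ i) (≋-sym (alt-⊗ e (M i zero) (Det n (M₀ i)))))
                                         (alt-comm (toℕ i) e (M i zero ⊗ Det n (M₀ i)))) ⟩
    sum (suc n) (λ i → alt e (alt (toℕ i) (M i zero ⊗ Det n (M₀ i))))
      ≈⟨ alt-sum (suc n) e (λ i → alt (toℕ i) (M i zero ⊗ Det n (M₀ i))) ⟨
    alt e (sum (suc n) (λ i → alt (toℕ i) (M i zero ⊗ Det n (M₀ i))))
      ≈⟨ alt-cong e (det-expandCol₀ n M) ⟨
    alt e (Det (suc n) M) ∎
    where
    M₀ : Fin (suc n) → Matrix n
    M₀ i r s = M (punchIn i r) (suc s)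

  -- moving column p to the front takes p adjacent transpositions
  det-toFront : ∀ n (p : Fin (suc n)) M → Det (suc n) (M ∘ᶜ toFront p) ≈ alt (toℕ p) (Det (suc n) M)
  det-toFront n zero M = det-cols-≡ (suc n) M toFront-zero
  det-toFront (suc n) (suc q) M = begin
    Det (suc (suc n)) (M ∘ᶜ toFront (suc q))
      ≈⟨ det-cols-≡ (suc (suc n)) M (toFront-suc q) ⟩
    Det (suc (suc n)) ((M ∘ᶜ lift (toFront q)) ∘ᶜ swap₀₁)
      ≈⟨ det-swap₀₁ n (M ∘ᶜ lift (toFront q)) ⟩
    neg (Det (suc (suc n)) (M ∘ᶜ lift (toFront q)))
      ≈⟨ neg-cong (det-lift (suc n) (toFront q) (toℕ q) (det-toFront n q) M) ⟩
    neg (alt (toℕ q) (Det (suc (suc n)) M))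
      ≈⟨ alt-suc (toℕ q) _ ⟨
    alt (toℕ (suc q)) (Det (suc (suc n)) M) ∎

  det-permute : ∀ n (π : PermCode n) M → Det n (M ∘ᶜ ⟦ π ⟧) ≈ alt (inversions π) (Det n M)
  det-permute zero [] M = ≋-refl
  det-permute (suc n) (p ∷ π) M = begin
    Det (suc n) (M ∘ᶜ ⟦ p ∷ π ⟧)
      ≈⟨ det-cols-≡ (suc n) M (⟦⟧-∷ p π) ⟩
    Det (suc n) ((M ∘ᶜ toFront p) ∘ᶜ lift ⟦ π ⟧)
      ≈⟨ det-lift n ⟦ π ⟧ (inversions π) (det-permute n π) (M ∘ᶜ toFront p) ⟩
    alt (inversions π) (Det (suc n) (M ∘ᶜ toFront p))
      ≈⟨ alt-cong (inversions π) (det-toFront n p M) ⟩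
    alt (inversions π) (alt (toℕ p) (Det (suc n) M))
      ≈⟨ alt-comm (inversions π) (toℕ p) _ ⟩
    alt (toℕ p) (alt (inversions π) (Det (suc n) M))
      ≈⟨ alt-+ (toℕ p) (inversions π) _ ⟩
    alt (inversions (p ∷ π)) (Det (suc n) M) ∎

  -- a repeated column makes the determinant vanish: move the two copies to the front
  det-repeatedCol : ∀ j {n} (B : Fin j → Fin n → Poly P k) (g : Fin j → Fin n) →
    Repeats g → Det j (B ∘ᶜ g) ≈ 𝟘
  det-repeatedCol (suc zero) B g (zero , zero , 0≢0 , _) = ⊥-elim (0≢0 refl)
  det-repeatedCol (suc (suc j)) B g (a , b , a≢b , ga≡gb) = begin
    Det (suc (suc j)) (B ∘ᶜ g)
      ≈⟨ alt-involutive (inversions π) _ ⟨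
    alt (inversions π) (alt (inversions π) (Det (suc (suc j)) (B ∘ᶜ g)))
      ≈⟨ alt-cong (inversions π) (det-permute (suc (suc j)) π (B ∘ᶜ g)) ⟨
    alt (inversions π) (Det (suc (suc j)) ((B ∘ᶜ g) ∘ᶜ ⟦ π ⟧))
      ≈⟨ alt-cong (inversions π) (det-equalCols₀₁ j ((B ∘ᶜ g) ∘ᶜ ⟦ π ⟧) front-equal) ⟩
    alt (inversions π) 𝟘
      ≈⟨ alt-𝟘 (inversions π) ⟩
    𝟘 ∎
    where
    -- 0 ↦ a and 1 ↦ b
    π : PermCode (suc (suc j))
    π = a ∷ (punchOut a≢b ∷ idCode j)
    front-equal : ∀ x → B x (g (⟦ π ⟧ zero)) ≈ B x (g (⟦ π ⟧ (suc zero)))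
    front-equal x = ≡⇒≈ (cong (B x) (trans ga≡gb (cong g (sym (FinP.punchIn-punchOut a≢b)))))

  -- Reindexing. To show that det of (B ∘ᶜ g) lies in an ideal it suffices to do so
  -- for increasing g: a general g either repeats a value or is an increasing
  -- map up to a column permutation.
  det-cols∈ : ∀ {ℓs} {S : Poly P k → Set ℓs} j {n} (B : Fin j → Fin n → Poly P k) →
    (∀ g → Increasing g → ⟨_⟩ P S (Det j (B ∘ᶜ g))) → ∀ g → ⟨_⟩ P S (Det j (B ∘ᶜ g))
  det-cols∈ j B increasing∈ g with repeats-or-sortable g
  ... | inj₁ repeats = resp (≋-sym (det-repeatedCol j B g repeats)) zro
  ... | inj₂ (g↑ , g↑-increasing , π , g≡g↑∘π) =
    resp (≋-sym sorted) (∈-alt (inversions π) (increasing∈ g↑ g↑-increasing))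
    where
    sorted : Det j (B ∘ᶜ g) ≈ alt (inversions π) (Det j (B ∘ᶜ g↑))
    sorted = ≋-trans (det-cols-≡ j B g≡g↑∘π) (det-permute j π (B ∘ᶜ g↑))

  det-reindex∈Minors : ∀ j {n} (A : Fin n → Fin n → Poly P k) (f g : Fin j → Fin n) →
    ⟨_⟩ P (Minors P j A) (Det j (λ a b → A (f a) (g b)))
  det-reindex∈Minors j A f = det-cols∈ j (λ a → A (f a)) sort-rows
    where
    sort-rows : ∀ g → Increasing g → ⟨_⟩ P (Minors P j A) (Det j (λ a b → A (f a) (g b)))
    sort-rows g g↑ = resp (det-transpose j (λ a b → A (f a) (g b)))
      (det-cols∈ j (λ b r → A r (g b)) (λ f' f'↑ →
         resp (≋-sym (det-transpose j (λ a b → A (f' a) (g b)))) (gen (f' , g , f'↑ , g↑ , refl))) f)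

-- Substitution homomorphisms and ideals

module Substitution {c ℓ : Level} (P : CommutativeRing c ℓ) where
  open CommutativeRing P using (0#; 1#)

  module _ {k m : ℕ} (τ : Fin k → Poly P m) where
    open PolyRing P m

    substP-cong : ∀ {p q} → _≋_ P p q → substP P τ p ≈ substP P τ q
    substP-cong ≋-refl = ≋-refl
    substP-cong (≋-sym e) = ≋-sym (substP-cong e)
    substP-cong (≋-trans e f) = ≋-trans (substP-cong e) (substP-cong f)
    substP-cong (⊕-cong e f) = ⊕-cong (substP-cong e) (substP-cong f)
    substP-cong (⊗-cong e f) = ⊗-cong (substP-cong e) (substP-cong f)
    substP-cong (neg-cong e) = neg-cong (substP-cong e)
    substP-cong (⊕-assoc p q r) = ⊕-assoc _ _ _
    substP-cong (⊕-comm p q) = ⊕-comm _ _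
    substP-cong (⊕-idˡ p) = ⊕-idˡ _
    substP-cong (neg-invˡ p) = neg-invˡ _
    substP-cong (⊗-assoc p q r) = ⊗-assoc _ _ _
    substP-cong (⊗-comm p q) = ⊗-comm _ _
    substP-cong (⊗-idˡ p) = ⊗-idˡ _
    substP-cong (⊗-distribˡ p q r) = ⊗-distribˡ _ _ _
    substP-cong (con-cong e) = con-cong e
    substP-cong (con-+ a b) = con-+ a b
    substP-cong (con-* a b) = con-* a b
    substP-cong (con-neg a) = con-neg a

    substP-alt : ∀ e p → substP P τ (altSign P e p) ≈ alt e (substP P τ p)
    substP-alt zero p = ≋-refl
    substP-alt (suc zero) p = ≋-refl
    substP-alt (suc (suc e)) p = substP-alt e p

    substP-sum : ∀ j f → substP P τ (sumFin P j f) ≈ sum j (λ i → substP P τ (f i))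
    substP-sum zero f = ≋-refl
    substP-sum (suc j) f = ⊕-cong ≋-refl (substP-sum j (λ i → f (suc i)))

    substP-det : ∀ j M → substP P τ (det P j M) ≈ det P j (λ a b → substP P τ (M a b))
    substP-det zero M = ≋-refl
    substP-det (suc j) M = ≋-trans (substP-sum (suc j) term) (sum-cong (suc j) λ i →
      ≋-trans (substP-alt (toℕ i) (M zero i ⊗ det P j (minor i)))
        (alt-cong (toℕ i) (⊗-cong {p = substP P τ (M zero i)} ≋-refl (substP-det j (minor i)))))
      where
      minor : Fin (suc j) → Fin j → Fin j → Poly P k
      minor i r s = M (suc r) (punchIn i s)
      term : Fin (suc j) → Poly P k
      term i = altSign P (toℕ i) (M zero i ⊗ det P j (minor i))

    substP-⟨⟩ : ∀ {ℓs ℓt} {S : Poly P k → Set ℓs} {T : Poly P m → Set ℓt} →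
      (∀ {p} → S p → ⟨_⟩ P T (substP P τ p)) → ∀ {p} → ⟨_⟩ P S p → ⟨_⟩ P T (substP P τ p)
    substP-⟨⟩ S⊆ (gen s) = S⊆ s
    substP-⟨⟩ S⊆ zro = zro
    substP-⟨⟩ S⊆ (add p∈ q∈) = add (substP-⟨⟩ S⊆ p∈) (substP-⟨⟩ S⊆ q∈)
    substP-⟨⟩ S⊆ (mul r p∈) = mul (substP P τ r) (substP-⟨⟩ S⊆ p∈)
    substP-⟨⟩ S⊆ (resp e p∈) = resp (substP-cong e) (substP-⟨⟩ S⊆ p∈)

  ⟨⟩-mono : ∀ {k ℓs ℓt} {S : Poly P k → Set ℓs} {T : Poly P k → Set ℓt} →
    (∀ {p} → S p → ⟨_⟩ P T p) → ∀ {p} → ⟨_⟩ P S p → ⟨_⟩ P T p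
  ⟨⟩-mono S⊆ (gen s) = S⊆ s
  ⟨⟩-mono S⊆ zro = zro
  ⟨⟩-mono S⊆ (add p∈ q∈) = add (⟨⟩-mono S⊆ p∈) (⟨⟩-mono S⊆ q∈)
  ⟨⟩-mono S⊆ (mul r p∈) = mul r (⟨⟩-mono S⊆ p∈)
  ⟨⟩-mono S⊆ (resp e p∈) = resp e (⟨⟩-mono S⊆ p∈)

  substP-difference : ∀ {k ℓs} {S : Poly P k → Set ℓs} (τ : Fin k → Poly P k) →
    (∀ i → ⟨_⟩ P S (var i ⊕ neg (τ i))) → ∀ p → ⟨_⟩ P S (p ⊕ neg (substP P τ p))
  substP-difference {k} τ var∈ = diff
    where
    open PolyRing P k
    product-difference : ∀ a b c d → (a ⊗ (b ⊕ neg d)) ⊕ (d ⊗ (a ⊕ neg c)) ≈ (a ⊗ b) ⊕ neg (c ⊗ d)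
    product-difference a b c d = begin
      (a ⊗ (b ⊕ neg d)) ⊕ (d ⊗ (a ⊕ neg c))
        ≈⟨ ⊕-cong (⊗-distribˡ _ _ _) (⊗-distribˡ _ _ _) ⟩
      ((a ⊗ b) ⊕ (a ⊗ neg d)) ⊕ ((d ⊗ a) ⊕ (d ⊗ neg c))
        ≈⟨ ⊕-cong (⊕-cong ≋-refl (≋-sym (-‿distribʳ-* a d)))
                  (⊕-cong (⊗-comm d a) (≋-trans (≋-sym (-‿distribʳ-* d c)) (neg-cong (⊗-comm d c)))) ⟩
      ((a ⊗ b) ⊕ neg (a ⊗ d)) ⊕ ((a ⊗ d) ⊕ neg (c ⊗ d))
        ≈⟨ ⊕-assoc _ _ _ ⟩
      (a ⊗ b) ⊕ (neg (a ⊗ d) ⊕ ((a ⊗ d) ⊕ neg (c ⊗ d)))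
        ≈⟨ ⊕-cong ≋-refl (≋-trans (≋-sym (⊕-assoc _ _ _))
                                  (≋-trans (⊕-cong (neg-invˡ _) ≋-refl) (⊕-idˡ _))) ⟩
      (a ⊗ b) ⊕ neg (c ⊗ d) ∎

    diff : ∀ p → ⟨_⟩ P _ (p ⊕ neg (substP P τ p))
    diff (con a) = resp (≋-sym (-‿inverseʳ _)) zro
    diff (var i) = var∈ i
    diff (p ⊕ q) = resp (≋-sym (≋-trans (⊕-cong ≋-refl (≋-sym (-‿+-comm _ _))) (⊕-interchange _ _ _ _)))
                        (add (diff p) (diff q))
    diff (p ⊗ q) = resp (product-difference p q (substP P τ p) (substP P τ q))
                        (add (mul p (diff q)) (mul (substP P τ q) (diff p)))
    diff (neg p) = resp (≋-sym (-‿+-comm _ _)) (∈-neg (diff p))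

  substP-idempotent : ∀ {k m} (σ : Fin m → Poly P m) (τ : Fin k → Poly P m) →
    (∀ i → substP P σ (τ i) ≡ τ i) → ∀ q → substP P σ (substP P τ q) ≡ substP P τ q
  substP-idempotent σ τ fixed (con a) = refl
  substP-idempotent σ τ fixed (var i) = fixed i
  substP-idempotent σ τ fixed (p ⊕ q) = cong₂ _⊕_ (substP-idempotent σ τ fixed p) (substP-idempotent σ τ fixed q)
  substP-idempotent σ τ fixed (p ⊗ q) = cong₂ _⊗_ (substP-idempotent σ τ fixed p) (substP-idempotent σ τ fixed q)
  substP-idempotent σ τ fixed (neg p) = cong neg (substP-idempotent σ τ fixed p)

  trivial⇒1∈ : ∀ {k ℓs} {S : Poly P k → Set ℓs} → Trivial P (⟨_⟩ P S) → ⟨_⟩ P S (con 1#)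
  trivial⇒1∈ trivial = Equivalence.from (trivial (con 1#)) (gen refl)

  1∈⇒trivial : ∀ {k ℓs} {S : Poly P k → Set ℓs} → ⟨_⟩ P S (con 1#) → Trivial P (⟨_⟩ P S)
  1∈⇒trivial {k} 1∈ p = mk⇔ (λ _ → resp (*-identityʳ p) (mul p (gen refl)))
                            (λ _ → resp (*-identityʳ p) (mul p 1∈))
    where open PolyRing P k

-- Entries of generalized Laplacians

module LaplacianEntries {c ℓ : Level} (P : CommutativeRing c ℓ) where
  open CommutativeRing P using (0#; 1#)

  arcEntry : ∀ {k} → Sign → ℕ → Poly P k
  arcEntry s m = neg (signedP P s (natP P m))

  arcEntry-0 : ∀ {k} s → _≋_ P {k} (arcEntry s 0) (con 0#)
  arcEntry-0 {k} Sign.+ = PolyRing.-0#≈0# P k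
  arcEntry-0 {k} Sign.- = PolyRing.-‿involutive P k (con 0#)

  substP-arcEntry : ∀ {k m} (τ : Fin k → Poly P m) s a → substP P τ (arcEntry s a) ≡ arcEntry s a
  substP-arcEntry τ Sign.+ a = cong neg (substP-natP a)
    where
    substP-natP : ∀ a → substP P τ (natP P a) ≡ natP P a
    substP-natP zero = refl
    substP-natP (suc a) = cong (con 1# ⊕_) (substP-natP a)
  substP-arcEntry τ Sign.- a = cong neg (substP-arcEntry τ Sign.+ a)

  Laplacian-diag : ∀ {n} (H : SignedMultidigraph n) u → Laplacian P H u u ≡ var u
  Laplacian-diag H u with u Fin.≟ u
  ... | yes _ = refl
  ... | no u≢u = ⊥-elim (u≢u refl)

  Laplacian-offdiag : ∀ {n} (H : SignedMultidigraph n) u w → u ≢ w →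
    Laplacian P H u w ≡ arcEntry (sign H u w) (arcs H u w)
  Laplacian-offdiag H u w u≢w with u Fin.≟ w
  ... | yes u≡w = ⊥-elim (u≢w u≡w)
  ... | no _ = refl

  substP-offdiag : ∀ {n} (τ : Fin n → Poly P n) (H : SignedMultidigraph n) u w → u ≢ w →
    substP P τ (Laplacian P H u w) ≡ Laplacian P H u w
  substP-offdiag τ H u w u≢w = begin
    substP P τ (Laplacian P H u w)                  ≡⟨ cong (substP P τ) (Laplacian-offdiag H u w u≢w) ⟩
    substP P τ (arcEntry (sign H u w) (arcs H u w)) ≡⟨ substP-arcEntry τ (sign H u w) (arcs H u w) ⟩
    arcEntry (sign H u w) (arcs H u w)              ≡⟨ Laplacian-offdiag H u w u≢w ⟨
    Laplacian P H u w                               ∎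
    where open Eq.≡-Reasoning

-- The duplicated graph d(G,v)

module Duplication {c ℓ : Level} (P : CommutativeRing c ℓ) {n : ℕ}
                   (G : SignedMultidigraph n) (v : Fin n) where
  open PolyRing P (suc n)
  open Determinants P (suc n) using (Det; det-cong; det-reindex∈Minors)
  open Substitution P
  open LaplacianEntries P

  D : SignedMultidigraph (suc n)
  D = dup G v

  LD : Fin (suc n) → Fin (suc n) → Poly P (suc n)
  LD = Laplacian P D

  collapse : Fin (suc n) → Fin n
  collapse zero = v
  collapse (suc u) = u

  -- column w of G inside d(G,v), with v replaced by its twin v¹
  twin : Fin n → Fin (suc n)
  twin w with w Fin.≟ v
  ... | yes _ = zero
  ... | no _ = suc w

  collapse-twin : ∀ w → collapse (twin w) ≡ w
  collapse-twin w with w Fin.≟ v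
  ... | yes w≡v = sym w≡v
  ... | no _ = refl

  twin-suc : ∀ w u → twin w ≡ suc u → (u ≡ w) × (u ≢ v)
  twin-suc w u with w Fin.≟ v
  ... | yes _ = λ ()
  ... | no w≢v = λ { refl → refl , w≢v }

  ζ : Fin n → Poly P (suc n)
  ζ = setZero P v

  ζ-v : ζ v ≡ 𝟘
  ζ-v with v Fin.≟ v
  ... | yes _ = refl
  ... | no v≢v = ⊥-elim (v≢v refl)

  ζ-other : ∀ {u} → u ≢ v → ζ u ≡ var (suc u)
  ζ-other {u} u≢v with u Fin.≟ v
  ... | yes u≡v = ⊥-elim (u≢v u≡v)
  ... | no _ = refl

  σ : Fin (suc n) → Poly P (suc n)
  σ x = ζ (collapse x)

  S : Fin n → Fin n → Poly P (suc n)
  S u w = substP P ζ (Laplacian P G u w)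

  S-diag : ∀ u → S u u ≡ ζ u
  S-diag u = cong (substP P ζ) (Laplacian-diag G u)

  S-offdiag : ∀ {u w} → u ≢ w → S u w ≡ arcEntry (sign G u w) (arcs G u w)
  S-offdiag {u} {w} u≢w =
    trans (cong (substP P ζ) (Laplacian-offdiag G u w u≢w)) (substP-arcEntry ζ (sign G u w) (arcs G u w))

  dup-sign : ∀ {x y} → x ≢ y → sign D x y ≡ sign G (collapse x) (collapse y)
  dup-sign {zero} {zero} x≢y = ⊥-elim (x≢y refl)
  dup-sign {zero} {suc w} _ = refl
  dup-sign {suc u} {zero} _ = refl
  dup-sign {suc u} {suc w} _ = refl

  dup-arcs : ∀ {x y} → collapse x ≢ collapse y → arcs D x y ≡ arcs G (collapse x) (collapse y)
  dup-arcs {zero} {zero} v≢v = ⊥-elim (v≢v refl)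
  dup-arcs {zero} {suc w} v≢w with w Fin.≟ v
  ... | yes w≡v = ⊥-elim (v≢w (sym w≡v))
  ... | no _ = refl
  dup-arcs {suc u} {zero} u≢v with u Fin.≟ v
  ... | yes u≡v = ⊥-elim (u≢v u≡v)
  ... | no _ = refl
  dup-arcs {suc u} {suc w} _ = refl

  dup-twins : ∀ {x y} → x ≢ y → collapse x ≡ collapse y → (collapse x ≡ v) × (arcs D x y ≡ 0)
  dup-twins {zero} {zero} x≢y _ = ⊥-elim (x≢y refl)
  dup-twins {zero} {suc w} _ v≡w with w Fin.≟ v
  ... | yes _ = refl , refl
  ... | no w≢v = ⊥-elim (w≢v (sym v≡w))
  dup-twins {suc u} {zero} _ u≡v with u Fin.≟ v
  ... | yes _ = u≡v , refl
  ... | no u≢v = ⊥-elim (u≢v u≡v)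
  dup-twins {suc u} {suc w} x≢y u≡w = ⊥-elim (x≢y (cong suc u≡w))

  offdiag-collapse : ∀ x y → x ≢ y → LD x y ≈ S (collapse x) (collapse y)
  offdiag-collapse x y x≢y = by-cases (collapse x Fin.≟ collapse y)
    where
    by-cases : Dec (collapse x ≡ collapse y) → LD x y ≈ S (collapse x) (collapse y)
    by-cases (yes cx≡cy) = begin
      LD x y                               ≡⟨ Laplacian-offdiag D x y x≢y ⟩
      arcEntry (sign D x y) (arcs D x y)   ≡⟨ cong (arcEntry (sign D x y)) arcs≡0 ⟩
      arcEntry (sign D x y) 0              ≈⟨ arcEntry-0 (sign D x y) ⟩
      𝟘                                    ≡⟨ trans (sym ζ-v) (cong ζ (sym cx≡v)) ⟩
      ζ (collapse x)                       ≡⟨ trans (sym (S-diag (collapse x))) (cong (S (collapse x)) cx≡cy) ⟩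
      S (collapse x) (collapse y)          ∎
      where
      cx≡v : collapse x ≡ v
      cx≡v = proj₁ (dup-twins x≢y cx≡cy)
      arcs≡0 : arcs D x y ≡ 0
      arcs≡0 = proj₂ (dup-twins x≢y cx≡cy)
    by-cases (no cx≢cy) = begin
      LD x y                                ≡⟨ Laplacian-offdiag D x y x≢y ⟩
      arcEntry (sign D x y) (arcs D x y)    ≡⟨ cong₂ arcEntry (dup-sign x≢y) (dup-arcs {x} {y} cx≢cy) ⟩
      arcEntry (sign G (collapse x) (collapse y)) (arcs G (collapse x) (collapse y))
                                            ≡⟨ S-offdiag cx≢cy ⟨
      S (collapse x) (collapse y)           ∎

  σ-Laplacian : ∀ x y → substP P σ (LD x y) ≈ S (collapse x) (collapse y)
  σ-Laplacian x y = by-cases (x Fin.≟ y)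
    where
    by-cases : Dec (x ≡ y) → substP P σ (LD x y) ≈ S (collapse x) (collapse y)
    by-cases (yes refl) = ≡⇒≈ (trans (cong (substP P σ) (Laplacian-diag D x)) (sym (S-diag (collapse x))))
    by-cases (no x≢y) = ≋-trans (≡⇒≈ (substP-offdiag σ D x y x≢y)) (offdiag-collapse x y x≢y)

  Laplacian-twin : ∀ u w → LD (suc u) (twin w) ≈ S u w
  Laplacian-twin u w = by-cases (suc u Fin.≟ twin w)
    where
    by-cases : Dec (suc u ≡ twin w) → LD (suc u) (twin w) ≈ S u w
    by-cases (no u≢tw) = subst (λ w' → LD (suc u) (twin w) ≈ S u w') (collapse-twin w)
                               (offdiag-collapse (suc u) (twin w) u≢tw)
    by-cases (yes u≡tw) with twin-suc w u (sym u≡tw)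
    ... | refl , u≢v = ≡⇒≈ (trans (cong (LD (suc u)) (sym u≡tw))
                             (trans (Laplacian-diag D (suc u)) (trans (sym (ζ-other u≢v)) (sym (S-diag u)))))

  σ-fixes-ζ : ∀ u → substP P σ (ζ u) ≡ ζ u
  σ-fixes-ζ u = by-cases (u Fin.≟ v)
    where
    by-cases : Dec (u ≡ v) → substP P σ (ζ u) ≡ ζ u
    by-cases (yes refl) = trans (cong (substP P σ) ζ-v) (sym ζ-v)
    by-cases (no u≢v) = cong (substP P σ) (ζ-other u≢v)

  minus-ζv : ∀ p → p ⊕ neg (ζ v) ≈ p
  minus-ζv p = ≋-trans (⊕-cong ≋-refl (≋-trans (neg-cong (≡⇒≈ ζ-v)) -0#≈0#)) (+-identityʳ p)

  module _ (j : ℕ) where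
    ID : Poly P (suc n) → Set (c ⊔ ℓ)
    ID = CriticalIdeal P j D

    J : Poly P (suc n) → Set (c ⊔ ℓ)
    J = Restrict0 P v (CriticalIdeal P j G)

    Target : Poly P (suc n) → Set (c ⊔ ℓ)
    Target = TargetIdeal P v J

    var-σ∈Target : ∀ x → Target (var x ⊕ neg (σ x))
    var-σ∈Target zero = resp (≋-sym (minus-ζv (var zero))) (gen (inj₂ (inj₁ refl)))
    var-σ∈Target (suc u) = by-cases (u Fin.≟ v)
      where
      by-cases : Dec (u ≡ v) → Target (var (suc u) ⊕ neg (ζ u))
      by-cases (yes refl) = resp (≋-sym (minus-ζv (var (suc v)))) (gen (inj₁ refl))
      by-cases (no u≢v) = resp (≋-sym (≋-trans (⊕-cong ≋-refl (neg-cong (≡⇒≈ (ζ-other u≢v))))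
                                               (-‿inverseʳ _)))
                               zro

    restrictedMinor∈J : ∀ {p} → Minors P j S p → J p
    restrictedMinor∈J (R , C , R↑ , C↑ , refl) =
      resp (substP-det ζ j (λ a b → Laplacian P G (R a) (C b))) (gen (_ , gen (R , C , R↑ , C↑ , refl) , refl))

    -- first claim: a minor p of L(d(G,v)) is (p - σ(p)) + σ(p), where p - σ(p) ∈ ⟨x_v, x_{v¹}⟩
    -- and σ(p) is a determinant of entries of L(G)|_{x_v=0}, hence lies in J
    critical⊆Target : ∀ p → ID p → Target p
    critical⊆Target _ = ⟨⟩-mono minor∈Target
      where
      minor∈Target : ∀ {p} → Minors P j LD p → Target p
      minor∈Target (R , C , _ , _ , refl) =
        resp split (add (substP-difference σ var-σ∈Target p) σp∈Target)
        where
        p : Poly P (suc n)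
        p = Det j (λ a b → LD (R a) (C b))
        collapsed : substP P σ p ≈ Det j (λ a b → S (collapse (R a)) (collapse (C b)))
        collapsed = ≋-trans (substP-det σ j (λ a b → LD (R a) (C b)))
                            (det-cong j (λ a b → σ-Laplacian (R a) (C b)))
        σp∈Target : Target (substP P σ p)
        σp∈Target = resp (≋-sym collapsed)
          (⟨⟩-mono (λ m → gen (inj₂ (inj₂ (restrictedMinor∈J m))))
                   (det-reindex∈Minors j S (λ a → collapse (R a)) (λ b → collapse (C b))))
        split : (p ⊕ neg (substP P σ p)) ⊕ substP P σ p ≈ p
        split = ≋-trans (⊕-assoc _ _ _) (≋-trans (⊕-cong ≋-refl (neg-invˡ _)) (+-identityʳ p))

    -- J ⊆ I_j(d(G,v)): the restriction of a minor of L(G) is a determinant of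
    -- entries of L(d(G,v)), namely rows u + 1 and columns twin w
    J⊆critical : ∀ {p} → J p → ID p
    J⊆critical = ⟨⟩-mono λ { (q , q∈IG , refl) → substP-⟨⟩ ζ restrictedMinor∈critical q∈IG }
      where
      restrictedMinor∈critical : ∀ {q} → Minors P j (Laplacian P G) q → ID (substP P ζ q)
      restrictedMinor∈critical (R , C , _ , _ , refl) = resp (≋-sym viaTwins)
        (det-reindex∈Minors j LD (λ a → suc (R a)) (λ b → twin (C b)))
        where
        viaTwins : substP P ζ (det P j (λ a b → Laplacian P G (R a) (C b)))
                   ≈ Det j (λ a b → LD (suc (R a)) (twin (C b)))
        viaTwins = ≋-trans (substP-det ζ j (λ a b → Laplacian P G (R a) (C b)))
                           (det-cong j (λ a b → ≋-sym (Laplacian-twin (R a) (C b))))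

    -- σ maps ⟨x_v, x_{v¹}, J⟩ into J: it kills x_v and x_{v¹} and fixes J
    σ[Target]⊆J : ∀ {p} → Target p → J (substP P σ p)
    σ[Target]⊆J = substP-⟨⟩ σ λ
      { (inj₁ refl) → resp (≋-sym (≡⇒≈ ζ-v)) zro
      ; (inj₂ (inj₁ refl)) → resp (≋-sym (≡⇒≈ ζ-v)) zro
      ; (inj₂ (inj₂ p∈J)) → substP-⟨⟩ σ (λ { (q , q∈IG , refl) →
          gen (q , q∈IG , substP-idempotent σ ζ σ-fixes-ζ q) }) p∈J }

    -- second claim: both ideals contain 1 or neither does
    trivial⇔ : Trivial P ID ⇔ Trivial P J
    trivial⇔ = mk⇔ (λ ID-trivial → 1∈⇒trivial (σ[Target]⊆J (critical⊆Target _ (trivial⇒1∈ ID-trivial))))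
                   (λ J-trivial → 1∈⇒trivial (J⊆critical (trivial⇒1∈ J-trivial)))

-- Lemma 2.4.

lemma2p4 : ∀ {c ℓ : Level} (P : CommutativeRing c ℓ) → IsPID P →
    (n : ℕ) → 2 ≤ n → (G : SignedMultidigraph n) (v : Fin n) →
    (j : ℕ) → 1 ≤ j → j ≤ n →
    (∀ p → CriticalIdeal P j (dup G v) p →
       TargetIdeal P v (Restrict0 P v (CriticalIdeal P j G)) p)
    × (Trivial P (CriticalIdeal P j (dup G v)) ⇔
       Trivial P (Restrict0 P v (CriticalIdeal P j G)))
lemma2p4 P _ n _ G v j _ _ = critical⊆Target j , trivial⇔ j
  where open Duplication P G v
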